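{- No even perfect number is ample. That is, if $n$ is an even positive integer with $\sigma(n) = 2n$, then $a(n) \leq n$.
   Context: $\sigma(n)$ denotes the sum of all positive divisors of $n$; $n$ is perfect if $\sigma(n) - n = n$. For positive integers, write $m \lfloor n$ to mean that $m$ is a proper divisor of $n$. The number of recursive divisors is defined by $a(1)=1$ and $a(n) = 1 + \sum_{m \lfloor n} a(m)$ for $n>1$. A positive integer $n$ is ample if $a(n) > n$. -}

module Defs where

open import Data.Nat using (ℕ; zero; suc; _+_; _∸_)
open import Data.Nat.Divisibility using (_∣?_)
open import Data.List using (List; []; _∷_; map; filter; upTo)
open import Data.Nat.ListAction using (sum)

divisors : ℕ → List ℕ
divisors n = filter (_∣? n) (map suc (upTo n))

properDivisors : ℕ → List ℕ
properDivisors n = filter (_∣? n) (map suc (upTo (n ∸ 1)))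

σ : ℕ → ℕ
σ n = sum (divisors n)

-- recursive divisor count with fuel (proper divisors are smaller, so fuel n suffices)
aFuel : ℕ → ℕ → ℕ
aFuel zero    n = 1
aFuel (suc f) n = 1 + sum (map (aFuel f) (properDivisors n))

-- a(1) = 1, a(n) = 1 + Σ_{m proper divisor of n} a(m)
a : ℕ → ℕ
a n = aFuel n n

-- Write n = 2^(k+1) m with m odd. Since σ (2^(k+1) m) + σ m = 2^(k+2) σ m, perfection gives
-- σ m = m + s with m + s = 2^(k+2) s. So s divides m, and s > 1 is impossible: 1, s and m would
-- then be distinct divisors of m with sum exceeding m + s. Hence σ m = m + 1, i.e. m is prime,
-- and m + 1 = 2^(k+2). For a prime q the proper divisors of 2^j lie among the 2^i with i < j,
-- and those of 2^j q among the 2^i with i ≤ j and the 2^i q with i < j; induction on j gives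
-- a (2^j) ≤ 2^j and a (2^j q) ≤ (j + 2) 2^j. Finally (k + 3) 2^(k+1) ≤ m 2^(k+1) = n.

module Submission where

open import Defs
open import Data.Nat
  using (ℕ; zero; suc; _+_; _∸_; _*_; _^_; _≤_; _<_; z≤n; s≤s; z<s; >-nonZero; >-nonZero⁻¹)
open import Data.Nat.Properties
open import Data.Nat.Divisibility
  using (_∣_; divides; _∣?_; ∣⇒≤; 0∣⇒≡0; ∣-refl; ∣-trans; m∣m*n; n∣m*n; *-cancelˡ-∣; *-monoʳ-∣;
         1∣_; ∣m+n∣m⇒∣n; ∣1⇒≡1)
open import Data.Nat.Coprimality using (Coprime; coprime-divisor)
open import Data.Nat.Induction using (<-wellFounded)
open import Data.Nat.ListAction using (sum)
open import Data.Nat.ListAction.Properties using (sum-++; sum-↭)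
open import Data.List using (List; []; _∷_; map; _++_; upTo; downFrom)
open import Data.List.Properties using (map-id; map-++; map-cong-local)
open import Data.List.Membership.Propositional using (_∈_)
open import Data.List.Membership.Propositional.Properties
open import Data.List.Membership.Propositional.Properties.WithK using (unique∧set⇒bag)
open import Data.List.Relation.Binary.Subset.Propositional using (_⊆_)
open import Data.List.Relation.Binary.BagAndSetEquality using (∼bag⇒↭)
open import Data.List.Relation.Binary.Permutation.Propositional.Properties using (shift; map⁺; ∈-resp-↭)
open import Data.List.Relation.Unary.Any using (here; there)
open import Data.List.Relation.Unary.All as All using ([]; _∷_)
open import Data.List.Relation.Unary.AllPairs using ([]; _∷_)
open import Data.List.Relation.Unary.Unique.Propositional using (Unique)
import Data.List.Relation.Unary.Unique.Propositional.Properties as Unique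
open import Data.Product using (∃-syntax; _×_; _,_; proj₁; proj₂)
open import Data.Sum using (_⊎_; inj₁; inj₂)
open import Data.Nat.Tactic.RingSolver using (solve-∀)
open import Function.Base using (id; _∘_)
open import Function.Bundles using (mk⇔)
open import Induction.WellFounded using (Acc; acc)
open import Relation.Nullary using (¬_; yes; no; contradiction)
open import Relation.Binary.PropositionalEquality
  using (_≡_; refl; sym; trans; cong; cong₂; subst; subst₂; module ≡-Reasoning)

sum-map-mono-⊆ : (f : ℕ → ℕ) {xs ys : List ℕ} → Unique xs → xs ⊆ ys →
                 sum (map f xs) ≤ sum (map f ys)
sum-map-mono-⊆ f {[]}     _                _     = z≤n
sum-map-mono-⊆ f {x ∷ xs} (x∉xs ∷ xs-uniq) xs⊆ys
  with as , bs , refl ← ∈-∃++ (xs⊆ys (here refl)) = begin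
    f x + sum (map f xs)         ≤⟨ +-monoʳ-≤ (f x) (sum-map-mono-⊆ f xs-uniq xs⊆as++bs) ⟩
    f x + sum (map f (as ++ bs)) ≡⟨ sum-↭ (map⁺ f (shift x as bs)) ⟨
    sum (map f (as ++ x ∷ bs))   ∎
  where
  open ≤-Reasoning
  xs⊆as++bs : xs ⊆ as ++ bs
  xs⊆as++bs y∈xs with ∈-resp-↭ (shift x as bs) (xs⊆ys (there y∈xs))
  ... | here refl      = contradiction refl (All.lookup x∉xs y∈xs)
  ... | there y∈as++bs = y∈as++bs

sum-mono-⊆ : {xs ys : List ℕ} → Unique xs → xs ⊆ ys → sum xs ≤ sum ys
sum-mono-⊆ {xs} {ys} xs-uniq xs⊆ys =
  subst₂ _≤_ (cong sum (map-id xs)) (cong sum (map-id ys)) (sum-map-mono-⊆ id xs-uniq xs⊆ys)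

∈-divisors⁺ : ∀ {d n} → 0 < n → d ∣ n → d ∈ divisors n
∈-divisors⁺ {zero}  {suc _} _ 0∣n with () ← 0∣⇒≡0 0∣n
∈-divisors⁺ {suc d} {suc n} _ d∣n =
  ∈-filter⁺ (_∣? suc n) (∈-map⁺ suc (∈-upTo⁺ (∣⇒≤ d∣n))) d∣n

∈-divisors⁻ : ∀ {d n} → d ∈ divisors n → d ∣ n
∈-divisors⁻ {n = n} d∈ = proj₂ (∈-filter⁻ (_∣? n) {xs = map suc (upTo n)} d∈)

divisors-unique : ∀ n → Unique (divisors n)
divisors-unique n = Unique.filter⁺ (_∣? n) (Unique.map⁺ suc-injective (Unique.upTo⁺ n))

∈-properDivisors⁻ : ∀ {d n} → d ∈ properDivisors n → d ∣ n × d < n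
∈-properDivisors⁻ {n = n} d∈
  with d∈′ , d∣n ← ∈-filter⁻ (_∣? n) {xs = map suc (upTo (n ∸ 1))} d∈
  with _ , i∈ , refl ← ∈-map⁻ suc d∈′
  with suc _ ← n = d∣n , s≤s (∈-upTo⁻ i∈)

properDivisors-unique : ∀ n → Unique (properDivisors n)
properDivisors-unique n = Unique.filter⁺ (_∣? n) (Unique.map⁺ suc-injective (Unique.upTo⁺ (n ∸ 1)))

aFuel-stable : ∀ f g n → n ≤ f → n ≤ g → aFuel f n ≡ aFuel g n
aFuel-stable zero    zero    _ _   _   = refl
aFuel-stable zero    (suc _) _ z≤n _   = refl
aFuel-stable (suc _) zero    _ _   z≤n = refl
aFuel-stable (suc f) (suc g) n n≤f n≤g =
  cong (λ ds → 1 + sum ds) (map-cong-local (All.tabulate λ d∈ →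
    let d<n = proj₂ (∈-properDivisors⁻ d∈) in
    aFuel-stable f g _ (≤-pred (≤-trans d<n n≤f)) (≤-pred (≤-trans d<n n≤g))))

a-unfold : ∀ n → 0 < n → a n ≡ 1 + sum (map a (properDivisors n))
a-unfold (suc n) _ = cong (λ ds → 1 + sum ds) (map-cong-local (All.tabulate λ d∈ →
  aFuel-stable n _ _ (≤-pred (proj₂ (∈-properDivisors⁻ d∈))) ≤-refl))

a≤1+sum-a : ∀ {n ds} → 0 < n → properDivisors n ⊆ ds → a n ≤ 1 + sum (map a ds)
a≤1+sum-a {n} n>0 pd⊆ds = subst (_≤ _) (sym (a-unfold n n>0))
  (+-monoʳ-≤ 1 (sum-map-mono-⊆ a (properDivisors-unique n) pd⊆ds))

odd⇒coprime-2 : ∀ {x} → ¬ 2 ∣ x → Coprime x 2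
odd⇒coprime-2 _     {zero}              (_ , 0∣2) with () ← 0∣⇒≡0 0∣2
odd⇒coprime-2 _     {suc zero}          _         = refl
odd⇒coprime-2 x-odd {suc (suc zero)}    (2∣x , _) = contradiction 2∣x x-odd
odd⇒coprime-2 _     {suc (suc (suc _))} (_ , d∣2) with s≤s (s≤s ()) ← ∣⇒≤ d∣2

∣2^k*m⇒≡2^i*z : ∀ k {m x} → x ∣ 2 ^ k * m → ∃[ i ] ∃[ z ] (i ≤ k × z ∣ m × x ≡ 2 ^ i * z)
∣2^k*m⇒≡2^i*z zero {m} {x} x∣m = 0 , x , z≤n , subst (x ∣_) (*-identityˡ m) x∣m , sym (*-identityˡ x)
∣2^k*m⇒≡2^i*z (suc k) {m} {x} x∣2^[1+k]*m
  with 2 ∣? x | subst (x ∣_) (*-assoc 2 (2 ^ k) m) x∣2^[1+k]*m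
... | no x-odd | x∣2*[2^k*m]
  with i , z , i≤k , z∣m , refl ← ∣2^k*m⇒≡2^i*z k (coprime-divisor (odd⇒coprime-2 x-odd) x∣2*[2^k*m])
  = i , z , m≤n⇒m≤1+n i≤k , z∣m , refl
... | yes (divides y refl) | y*2∣2*[2^k*m]
  with i , z , i≤k , z∣m , refl ← ∣2^k*m⇒≡2^i*z k {x = y}
         (*-cancelˡ-∣ 2 (subst (_∣ 2 * (2 ^ k * m)) (*-comm y 2) y*2∣2*[2^k*m]))
  = suc i , z , s≤s i≤k , z∣m , trans (*-comm (2 ^ i * z) 2) (sym (*-assoc 2 (2 ^ i) z))

n≡2^k*odd : ∀ n → 0 < n → ∃[ k ] ∃[ m ] (n ≡ 2 ^ k * m × ¬ 2 ∣ m)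
n≡2^k*odd n = go n (<-wellFounded n)
  where
  go : ∀ n → Acc _<_ n → 0 < n → ∃[ k ] ∃[ m ] (n ≡ 2 ^ k * m × ¬ 2 ∣ m)
  go n (acc rec) n>0 with 2 ∣? n
  ... | no n-odd = 0 , n , sym (*-identityˡ n) , n-odd
  ... | yes (divides zero refl) with () ← n>0
  ... | yes (divides q@(suc _) refl)
    with k , m , q≡2^k*m , m-odd ← go q (rec (m<m*n q 2 ≤-refl)) z<s
    = suc k , m , trans (cong (_* 2) q≡2^k*m) (trans (*-comm (2 ^ k * m) 2) (sym (*-assoc 2 (2 ^ k) m))) ,
      m-odd

sum-map-*ˡ : ∀ c xs → sum (map (c *_) xs) ≡ c * sum xs
sum-map-*ˡ c []       = sym (*-zeroʳ c)
sum-map-*ˡ c (x ∷ xs) = trans (cong (c * x +_) (sum-map-*ˡ c xs)) (sym (*-distribˡ-+ c x (sum xs)))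

doubledDivisors : ℕ → ℕ → List ℕ
doubledDivisors m zero    = divisors m
doubledDivisors m (suc k) = divisors m ++ map (2 *_) (doubledDivisors m k)

doubledDivisors-unique : ∀ {m} → ¬ 2 ∣ m → ∀ k → Unique (doubledDivisors m k)
doubledDivisors-unique {m} m-odd zero    = divisors-unique m
doubledDivisors-unique {m} m-odd (suc k) = Unique.++⁺ (divisors-unique m)
  (Unique.map⁺ (*-cancelˡ-≡ _ _ 2) (doubledDivisors-unique m-odd k))
  λ (d∈ , 2*e∈) → m-odd (∣-trans (even 2*e∈) (∈-divisors⁻ d∈))
  where
  even : ∀ {d xs} → d ∈ map (2 *_) xs → 2 ∣ d
  even 2*e∈ with e , _ , refl ← ∈-map⁻ (2 *_) 2*e∈ = m∣m*n e

∈-doubledDivisors⁻ : ∀ {m d} k → d ∈ doubledDivisors m k → d ∣ 2 ^ k * m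
∈-doubledDivisors⁻ {m} {d} zero d∈ = subst (d ∣_) (sym (*-identityˡ m)) (∈-divisors⁻ d∈)
∈-doubledDivisors⁻ {m} (suc k) d∈ with ∈-++⁻ (divisors m) d∈
... | inj₁ d∈D  = ∣-trans (∈-divisors⁻ d∈D) (n∣m*n (2 ^ suc k))
... | inj₂ 2*e∈ with e , e∈ , refl ← ∈-map⁻ (2 *_) 2*e∈ =
  subst (2 * e ∣_) (sym (*-assoc 2 (2 ^ k) m)) (*-monoʳ-∣ 2 (∈-doubledDivisors⁻ k e∈))

∈-doubledDivisors⁺ : ∀ {m i k z} → 0 < m → i ≤ k → z ∣ m → 2 ^ i * z ∈ doubledDivisors m k
∈-doubledDivisors⁺ {m} {zero} {zero}  {z} m>0 _ z∣m =
  subst (_∈ divisors m) (sym (*-identityˡ z)) (∈-divisors⁺ m>0 z∣m)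
∈-doubledDivisors⁺ {m} {zero} {suc _} {z} m>0 _ z∣m =
  ∈-++⁺ˡ (subst (_∈ divisors m) (sym (*-identityˡ z)) (∈-divisors⁺ m>0 z∣m))
∈-doubledDivisors⁺ {m} {suc i} {suc k} {z} m>0 (s≤s i≤k) z∣m =
  subst (_∈ doubledDivisors m (suc k)) (sym (*-assoc 2 (2 ^ i) z))
    (∈-++⁺ʳ (divisors m) (∈-map⁺ (2 *_) (∈-doubledDivisors⁺ m>0 i≤k z∣m)))

sum-doubledDivisors : ∀ m k → sum (doubledDivisors m k) + σ m ≡ 2 ^ suc k * σ m
sum-doubledDivisors m zero    = cong (σ m +_) (sym (+-identityʳ (σ m)))
sum-doubledDivisors m (suc k) = begin
  sum (divisors m ++ map (2 *_) L) + σ m ≡⟨ cong (_+ σ m) (sum-++ (divisors m) (map (2 *_) L)) ⟩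
  σ m + sum (map (2 *_) L) + σ m        ≡⟨ cong (λ t → σ m + t + σ m) (sum-map-*ˡ 2 L) ⟩
  σ m + 2 * sum L + σ m                ≡⟨ regroup (σ m) (sum L) ⟩
  2 * (sum L + σ m)                    ≡⟨ cong (2 *_) (sum-doubledDivisors m k) ⟩
  2 * (2 ^ suc k * σ m)                ≡⟨ *-assoc 2 (2 ^ suc k) (σ m) ⟨
  2 ^ suc (suc k) * σ m                ∎
  where
  open ≡-Reasoning
  L : List ℕ
  L = doubledDivisors m k
  regroup : ∀ s t → s + 2 * t + s ≡ 2 * (t + s)
  regroup = solve-∀

σ[2^k*m]≡sum-doubledDivisors : ∀ {m} → 0 < m → ¬ 2 ∣ m → ∀ k →
                               σ (2 ^ k * m) ≡ sum (doubledDivisors m k)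
σ[2^k*m]≡sum-doubledDivisors {m} m>0 m-odd k =
  sum-↭ (∼bag⇒↭ (unique∧set⇒bag (divisors-unique (2 ^ k * m)) (doubledDivisors-unique m-odd k)
    (mk⇔ to (λ d∈ → ∈-divisors⁺ (*-mono-< (m^n>0 2 k) m>0) (∈-doubledDivisors⁻ k d∈)))))
  where
  to : ∀ {d} → d ∈ divisors (2 ^ k * m) → d ∈ doubledDivisors m k
  to d∈ with i , z , i≤k , z∣m , refl ← ∣2^k*m⇒≡2^i*z k (∈-divisors⁻ d∈) =
    ∈-doubledDivisors⁺ m>0 i≤k z∣m

-- σ (2^k m) = (2^(k+1) − 1) σ m, stated without truncated subtraction.
σ[2^k*m]+σ[m]≡2^[1+k]*σ[m] : ∀ {m} → 0 < m → ¬ 2 ∣ m → ∀ k →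
                             σ (2 ^ k * m) + σ m ≡ 2 ^ suc k * σ m
σ[2^k*m]+σ[m]≡2^[1+k]*σ[m] {m} m>0 m-odd k =
  trans (cong (_+ σ m) (σ[2^k*m]≡sum-doubledDivisors m>0 m-odd k)) (sum-doubledDivisors m k)

m≤σ[m] : ∀ {m} → 0 < m → m ≤ σ m
m≤σ[m] {m} m>0 = subst (_≤ σ m) (+-identityʳ m)
  (sum-mono-⊆ ([] ∷ []) λ { (here refl) → ∈-divisors⁺ m>0 ∣-refl })

1+d+m≤σ[m] : ∀ {m d} → 1 < d → d < m → d ∣ m → 1 + (d + m) ≤ σ m
1+d+m≤σ[m] {m} {d} 1<d d<m d∣m = subst (_≤ σ m) (cong (λ t → 1 + (d + t)) (+-identityʳ m))
  (sum-mono-⊆ distinct λ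
    { (here refl)                 → ∈-divisors⁺ m>0 (1∣ m)
    ; (there (here refl))         → ∈-divisors⁺ m>0 d∣m
    ; (there (there (here refl))) → ∈-divisors⁺ m>0 ∣-refl })
  where
  m>0 : 0 < m
  m>0 = <-trans (<-trans z<s 1<d) d<m
  distinct : Unique (1 ∷ d ∷ m ∷ [])
  distinct = (<⇒≢ 1<d ∷ <⇒≢ (<-trans 1<d d<m) ∷ []) ∷ (<⇒≢ d<m ∷ []) ∷ [] ∷ []

σ[m]≡1+m⇒prime : ∀ {m} → 0 < m → σ m ≡ 1 + m → ∀ {d} → d ∣ m → d ≡ 1 ⊎ d ≡ m
σ[m]≡1+m⇒prime {m} m>0 σ≡1+m {d} d∣m with d ≟ 1 | d ≟ m
... | yes d≡1 | _       = inj₁ d≡1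
... | no _    | yes d≡m = inj₂ d≡m
... | no d≢1  | no d≢m  =
  contradiction (subst (1 + (d + m) ≤_) σ≡1+m (1+d+m≤σ[m] 1<d d<m d∣m)) 1+d+m≰1+m
  where
  d<m : d < m
  d<m = ≤∧≢⇒< (∣⇒≤ ⦃ >-nonZero m>0 ⦄ d∣m) d≢m
  1<d : 1 < d
  1<d = ≤∧≢⇒< (n≢0⇒n>0 λ { refl → n>0⇒n≢0 m>0 (0∣⇒≡0 d∣m) }) (d≢1 ∘ sym)
  1+d+m≰1+m : ¬ 1 + (d + m) ≤ 1 + m
  1+d+m≰1+m 1+d+m≤1+m = <⇒≱ 1<d (≤-trans (+-cancelʳ-≤ m d 0 (≤-pred 1+d+m≤1+m)) z≤n)

σ[m]≡m+s∧m+s≡P*s⇒s≡1 : ∀ {m s P} → 0 < m → 3 ≤ P → σ m ≡ m + s → m + s ≡ P * s → s ≡ 1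
σ[m]≡m+s∧m+s≡P*s⇒s≡1 {m} {zero} {P} m>0 _ _ m+0≡P*0 =
  contradiction (trans (sym (+-identityʳ m)) (trans m+0≡P*0 (*-zeroʳ P))) (n>0⇒n≢0 m>0)
σ[m]≡m+s∧m+s≡P*s⇒s≡1 {s = suc zero} _ _ _ _ = refl
σ[m]≡m+s∧m+s≡P*s⇒s≡1 {m} {s@(suc (suc _))} {P} _ 3≤P σ≡m+s m+s≡P*s =
  contradiction (subst (1 + (s + m) ≤_) σ≡m+s (1+d+m≤σ[m] (s≤s (s≤s z≤n)) s<m s∣m)) 1+s+m≰m+s
  where
  s∣m : s ∣ m
  s∣m = ∣m+n∣m⇒∣n (subst (s ∣_) (trans (sym m+s≡P*s) (+-comm m s)) (n∣m*n P)) ∣-refl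
  s<m : s < m
  s<m = <-≤-trans (m<m+n s z<s) (+-cancelʳ-≤ s (s + s) m (begin
    s + s + s   ≡⟨ +-assoc s s s ⟩
    s + (s + s) ≡⟨ cong (λ t → s + (s + t)) (+-identityʳ s) ⟨
    3 * s       ≤⟨ *-monoˡ-≤ s 3≤P ⟩
    P * s       ≡⟨ m+s≡P*s ⟨
    m + s       ∎))
    where open ≤-Reasoning
  1+s+m≰m+s : ¬ 1 + (s + m) ≤ m + s
  1+s+m≰m+s 1+s+m≤m+s = n≮n (m + s) (subst (_≤ m + s) (cong suc (+-comm s m)) 1+s+m≤m+s)

even-perfect⇒mersenne-prime : ∀ {k m} → 0 < m → ¬ 2 ∣ m → σ (2 ^ suc k * m) ≡ 2 * (2 ^ suc k * m) →
                              σ m ≡ 1 + m × 1 + m ≡ 2 ^ suc (suc k)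
even-perfect⇒mersenne-prime {k} {m} m>0 m-odd perfect =
  trans σ≡m+s (trans (cong (m +_) s≡1) (+-comm m 1)) ,
  (begin
    1 + m ≡⟨ +-comm 1 m ⟩
    m + 1 ≡⟨ cong (m +_) s≡1 ⟨
    m + s ≡⟨ m+s≡P*s ⟩
    P * s ≡⟨ cong (P *_) s≡1 ⟩
    P * 1 ≡⟨ *-identityʳ P ⟩
    P     ∎)
  where
  open ≡-Reasoning
  P s : ℕ
  P = 2 ^ suc (suc k)
  s = σ m ∸ m
  σ≡m+s : σ m ≡ m + s
  σ≡m+s = sym (m+[n∸m]≡n (m≤σ[m] m>0))
  m+s≡P*s : m + s ≡ P * s
  m+s≡P*s = +-cancelˡ-≡ (P * m) (m + s) (P * s) (begin
    P * m + (m + s)             ≡⟨ cong₂ _+_ (*-assoc 2 (2 ^ suc k) m) (sym σ≡m+s) ⟩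
    2 * (2 ^ suc k * m) + σ m   ≡⟨ cong (_+ σ m) perfect ⟨
    σ (2 ^ suc k * m) + σ m     ≡⟨ σ[2^k*m]+σ[m]≡2^[1+k]*σ[m] m>0 m-odd (suc k) ⟩
    P * σ m                     ≡⟨ cong (P *_) σ≡m+s ⟩
    P * (m + s)                 ≡⟨ *-distribˡ-+ P m s ⟩
    P * m + P * s               ∎)
  s≡1 : s ≡ 1
  s≡1 = σ[m]≡m+s∧m+s≡P*s⇒s≡1 m>0 3≤P σ≡m+s m+s≡P*s
    where
    3≤P : 3 ≤ P
    3≤P = ≤-trans (n≤1+n 3) (^-monoʳ-≤ 2 {2} {suc (suc k)} (s≤s (s≤s z≤n)))

powersOfTwoBelow : ℕ → List ℕ
powersOfTwoBelow j = map (2 ^_) (downFrom j)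

∈-powersOfTwoBelow⁺ : ∀ {i j} → i < j → 2 ^ i ∈ powersOfTwoBelow j
∈-powersOfTwoBelow⁺ i<j = ∈-map⁺ (2 ^_) (∈-downFrom⁺ i<j)

2^i*z<2^j*z⇒i<j : ∀ i j z → 2 ^ i * z < 2 ^ j * z → i < j
2^i*z<2^j*z⇒i<j i j z 2^i*z<2^j*z =
  ≰⇒> λ j≤i → <⇒≱ (*-cancelʳ-< z (2 ^ i) (2 ^ j) 2^i*z<2^j*z) (^-monoʳ-≤ 2 j≤i)

properDivisors-2^j⊆ : ∀ j → properDivisors (2 ^ j) ⊆ powersOfTwoBelow j
properDivisors-2^j⊆ j d∈ with d∣2^j , d<2^j ← ∈-properDivisors⁻ d∈
  with i , z , _ , z∣1 , refl ← ∣2^k*m⇒≡2^i*z j {1} (subst (_ ∣_) (sym (*-identityʳ (2 ^ j))) d∣2^j)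
  with refl ← ∣1⇒≡1 z∣1 = subst (_∈ powersOfTwoBelow j) (sym (*-identityʳ (2 ^ i))) (∈-powersOfTwoBelow⁺ i<j)
  where
  i<j : i < j
  i<j = 2^i*z<2^j*z⇒i<j i j 1 (subst (2 ^ i * 1 <_) (sym (*-identityʳ (2 ^ j))) d<2^j)

1+sum-a-powersOfTwoBelow≤2^j : ∀ j → 1 + sum (map a (powersOfTwoBelow j)) ≤ 2 ^ j
1+sum-a-powersOfTwoBelow≤2^j zero    = ≤-refl
1+sum-a-powersOfTwoBelow≤2^j (suc j) = begin
  1 + (a (2 ^ j) + S) ≡⟨ cong suc (+-comm (a (2 ^ j)) S) ⟩
  1 + S + a (2 ^ j)   ≤⟨ +-mono-≤ IH (≤-trans (a≤1+sum-a (m^n>0 2 j) (properDivisors-2^j⊆ j)) IH) ⟩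
  2 ^ j + 2 ^ j       ≡⟨ cong (2 ^ j +_) (+-identityʳ (2 ^ j)) ⟨
  2 ^ suc j           ∎
  where
  open ≤-Reasoning
  S : ℕ
  S = sum (map a (powersOfTwoBelow j))
  IH : 1 + S ≤ 2 ^ j
  IH = 1+sum-a-powersOfTwoBelow≤2^j j

module _ {q : ℕ} (q>0 : 0 < q) (q-prime : ∀ {d} → d ∣ q → d ≡ 1 ⊎ d ≡ q) where

  properDivisors-2^j*q⊆ : ∀ j → properDivisors (2 ^ j * q) ⊆
                                 powersOfTwoBelow (suc j) ++ map (_* q) (powersOfTwoBelow j)
  properDivisors-2^j*q⊆ j d∈ with d∣2^j*q , d<2^j*q ← ∈-properDivisors⁻ d∈
    with i , z , i≤j , z∣q , refl ← ∣2^k*m⇒≡2^i*z j d∣2^j*q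
    with q-prime z∣q
  ... | inj₁ refl = ∈-++⁺ˡ (subst (_∈ powersOfTwoBelow (suc j)) (sym (*-identityʳ (2 ^ i)))
                      (∈-powersOfTwoBelow⁺ (s≤s i≤j)))
  ... | inj₂ refl = ∈-++⁺ʳ (powersOfTwoBelow (suc j))
                      (∈-map⁺ (_* q) (∈-powersOfTwoBelow⁺ (2^i*z<2^j*z⇒i<j i j q d<2^j*q)))

  a[2^j*q]≤2^[1+j]+sum : ∀ j → a (2 ^ j * q) ≤ 2 ^ suc j + sum (map a (map (_* q) (powersOfTwoBelow j)))
  a[2^j*q]≤2^[1+j]+sum j = begin
    a (2 ^ j * q)                       ≤⟨ a≤1+sum-a (*-mono-< (m^n>0 2 j) q>0) (properDivisors-2^j*q⊆ j) ⟩
    1 + sum (map a (P ++ Q))            ≡⟨ cong (λ ds → 1 + sum ds) (map-++ a P Q) ⟩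
    1 + sum (map a P ++ map a Q)        ≡⟨ cong suc (sum-++ (map a P) (map a Q)) ⟩
    1 + (sum (map a P) + sum (map a Q)) ≤⟨ +-monoˡ-≤ (sum (map a Q)) (1+sum-a-powersOfTwoBelow≤2^j (suc j)) ⟩
    2 ^ suc j + sum (map a Q)           ∎
    where
    open ≤-Reasoning
    P Q : List ℕ
    P = powersOfTwoBelow (suc j)
    Q = map (_* q) (powersOfTwoBelow j)

  sum-a-2^i*q≤j*2^j : ∀ j → sum (map a (map (_* q) (powersOfTwoBelow j))) ≤ j * 2 ^ j
  sum-a-2^i*q≤j*2^j zero    = z≤n
  sum-a-2^i*q≤j*2^j (suc j) = begin
    a (2 ^ j * q) + T                   ≤⟨ +-monoˡ-≤ T (a[2^j*q]≤2^[1+j]+sum j) ⟩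
    2 * 2 ^ j + T + T                   ≤⟨ +-mono-≤ (+-monoʳ-≤ (2 * 2 ^ j) IH) IH ⟩
    2 * 2 ^ j + j * 2 ^ j + j * 2 ^ j   ≡⟨ regroup j (2 ^ j) ⟩
    suc j * (2 * 2 ^ j)                 ∎
    where
    open ≤-Reasoning
    T : ℕ
    T = sum (map a (map (_* q) (powersOfTwoBelow j)))
    IH : T ≤ j * 2 ^ j
    IH = sum-a-2^i*q≤j*2^j j
    regroup : ∀ j X → 2 * X + j * X + j * X ≡ suc j * (2 * X)
    regroup = solve-∀

  a[2^j*q]≤[2+j]*2^j : ∀ j → a (2 ^ j * q) ≤ (2 + j) * 2 ^ j
  a[2^j*q]≤[2+j]*2^j j = begin
    a (2 ^ j * q)           ≤⟨ a[2^j*q]≤2^[1+j]+sum j ⟩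
    2 * 2 ^ j + _           ≤⟨ +-monoʳ-≤ (2 * 2 ^ j) (sum-a-2^i*q≤j*2^j j) ⟩
    2 * 2 ^ j + j * 2 ^ j   ≡⟨ *-distribʳ-+ (2 ^ j) 2 j ⟨
    (2 + j) * 2 ^ j         ∎
    where open ≤-Reasoning

4+k≤2^[2+k] : ∀ k → 4 + k ≤ 2 ^ (2 + k)
4+k≤2^[2+k] zero    = ≤-refl
4+k≤2^[2+k] (suc k) = begin
  1 + (4 + k)               ≡⟨ +-comm 1 (4 + k) ⟩
  (4 + k) + 1               ≤⟨ +-monoʳ-≤ (4 + k) (s≤s z≤n) ⟩
  (4 + k) + (4 + k)         ≤⟨ +-mono-≤ IH IH ⟩
  2 ^ (2 + k) + 2 ^ (2 + k) ≡⟨ cong (2 ^ (2 + k) +_) (+-identityʳ (2 ^ (2 + k))) ⟨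
  2 ^ (3 + k)               ∎
  where
  open ≤-Reasoning
  IH : 4 + k ≤ 2 ^ (2 + k)
  IH = 4+k≤2^[2+k] k

lemma2 : (n : ℕ) → 0 < n → 2 ∣ n → σ n ≡ 2 * n → a n ≤ n
lemma2 n n>0 2∣n perfect with n≡2^k*odd n n>0
... | zero  , m , refl , m-odd = contradiction (subst (2 ∣_) (*-identityˡ m) 2∣n) m-odd
... | suc k , m , refl , m-odd = begin
  a (2 ^ suc k * m)   ≤⟨ a[2^j*q]≤[2+j]*2^j m>0 (σ[m]≡1+m⇒prime m>0 σ≡1+m) (suc k) ⟩
  (3 + k) * 2 ^ suc k ≤⟨ *-monoˡ-≤ (2 ^ suc k) 3+k≤m ⟩
  m * 2 ^ suc k       ≡⟨ *-comm m (2 ^ suc k) ⟩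
  2 ^ suc k * m       ∎
  where
  open ≤-Reasoning
  m>0 : 0 < m
  m>0 = >-nonZero⁻¹ m ⦃ m*n≢0⇒n≢0 (2 ^ suc k) ⦃ >-nonZero n>0 ⦄ ⦄
  mersenne : σ m ≡ 1 + m × 1 + m ≡ 2 ^ (2 + k)
  mersenne = even-perfect⇒mersenne-prime {k} m>0 m-odd perfect
  σ≡1+m : σ m ≡ 1 + m
  σ≡1+m = proj₁ mersenne
  3+k≤m : 3 + k ≤ m
  3+k≤m = ≤-pred (subst (4 + k ≤_) (sym (proj₂ mersenne)) (4+k≤2^[2+k] k))
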